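{- Let $r\ge2$ and let $F=K_{a_1,\ldots,a_r}$ be an almost balanced complete $r$-partite graph with $a_1\ge\cdots\ge a_r\ge1$, let $\ell=a_1+\cdots+a_r$, and let $m=m_{r,\ell}$. Then \[\binom{\ell}{2}>m\sum_{k=1}^{r}\binom{a_k}{2}.\]
   Context: $K_{a_1,\ldots,a_r}$ is the complete $r$-partite graph with part sizes $a_1,\ldots,a_r$; it is almost balanced if it is not a complete graph and $\binom{a_1-a_r}{2}<a_r$ (so in particular $\ell\ge r+1$). $m_{r,\ell}$ is the unique integer $k\ge r$ maximizing $f(k)=\frac{(k-1)(k-2)\cdots(k-r+1)}{k^{\ell-1}}$ over integers $k\ge r$. -}

module Defs where

open import Data.Nat using (ℕ; zero; suc; _+_; _*_; _∸_; _^_; _≤_; _<_)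
open import Data.Nat.ListAction using (sum; product)
open import Data.Nat.Combinatorics using (_C_)
open import Data.List using (List; map; upTo; tabulate)
open import Data.Fin using (Fin; fromℕ) renaming (zero to zeroF)
open import Data.Product using (_×_)
open import Relation.Binary.PropositionalEquality using (_≡_)
open import Relation.Nullary using (¬_)

-- Part sizes of K_{a_1,...,a_r} are given as a : Fin r → ℕ with r = suc n;
-- index 0 is a_1, index (fromℕ n) is a_r.

total : ∀ {r} → (Fin r → ℕ) → ℕ
total a = sum (tabulate a)

sumPairs : ∀ {r} → (Fin r → ℕ) → ℕ
sumPairs a = sum (tabulate (λ i → a i C 2))

IsComplete : ∀ {r} → (Fin r → ℕ) → Set
IsComplete a = ∀ i → a i ≡ 1

AlmostBalanced : ∀ {n} → (Fin (suc n) → ℕ) → Set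
AlmostBalanced {n} a =
  (¬ IsComplete a) × (((a zeroF ∸ a (fromℕ n)) C 2) < a (fromℕ n))

fallNum : ℕ → ℕ → ℕ
fallNum r k = product (map (λ i → k ∸ suc i) (upTo (r ∸ 1)))

-- f(k) ≤ f(m) where f(x) = (x-1)...(x-r+1) / x^(ℓ-1), cross-multiplied
-- (both denominators are positive for k, m ≥ r ≥ 2).
fLeq : (r ℓ k m : ℕ) → Set
fLeq r ℓ k m = fallNum r k * m ^ (ℓ ∸ 1) ≤ fallNum r m * k ^ (ℓ ∸ 1)

-- m maximizes f over integers k ≥ r (m_{r,ℓ} is the unique such m)
IsMaximizer : (r ℓ m : ℕ) → Set
IsMaximizer r ℓ m = (r ≤ m) × (∀ k → r ≤ k → fLeq r ℓ k m)

-- Write aᵢ = b + eᵢ with b = a_r and 0 ≤ eᵢ ≤ d = a₁ - a_r, and put E = Σ eᵢ, F = r d - E.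
-- Since eᵢ² ≤ d eᵢ, 2 Σ C(aᵢ, 2) ≤ Q = r b (b - 1) + (2b - 1 + d) E, and r Q = ℓ g + E F with g = ℓ - r;
-- so with m = r + v it suffices that (v + r)(ℓ g + E F) < r ℓ (ℓ - 1).
-- For v = 0 this is E F < (r - 1) ℓ, a quadratic in E whose discriminant is negative because C(d, 2) < b.
-- For v > 0, f(m - 1) ≤ f(m) and the second-order binomial bound on (1 + 1/(m - 1))^(ℓ-1) make v small:
-- if b = 1 then d ≤ 1 and 2 E v < r (r - 1), which suffices; if b ≥ 2 they give v g (ℓ + 2p) ≤ 2p³ with
-- p = r - 1, forcing p ≥ 4, and then E F (ℓ + 4p) < p ℓ² (again a discriminant estimate) closes the gap.

module Submission where

open import Defs
open import Data.Nat using (ℕ; zero; suc; _+_; _*_; _∸_; _^_; _≤_; _<_; z≤n; s≤s; NonZero; >-nonZero)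
open import Data.Nat.Properties
open import Data.Nat.Tactic.RingSolver using (solve-∀; solve)
open import Data.Nat.ListAction using (sum; product)
open import Data.Nat.ListAction.Properties using (product≢0)
open import Data.Nat.Combinatorics using (_C_; nC1≡n; nCk+nC[k+1]≡[n+1]C[k+1])
open import Data.List using (applyUpTo; tabulate; []; _∷_)
open import Data.List.Properties using (map-upTo; tabulate-cong)
open import Data.List.Relation.Unary.All.Properties using (applyUpTo⁺₁)
open import Data.Fin using (Fin; fromℕ; toℕ) renaming (zero to fzero; suc to fsuc)
open import Data.Fin.Properties using (toℕ-fromℕ; toℕ≤pred[n])
open import Data.Product using (_,_)
open import Data.Sum using (inj₁; inj₂)
open import Data.Unit using (tt)
open import Function using (_∘_)
open import Algebra.Properties.CommutativeSemigroup *-commutativeSemigroup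
  using (x∙yz≈xz∙y; x∙yz≈y∙xz; xy∙z≈xz∙y; xy∙z≈y∙xz)
open import Algebra.Properties.CommutativeSemigroup +-commutativeSemigroup
  using () renaming (interchange to +-interchange)
open import Relation.Nullary using (yes; no; contradiction)
open import Relation.Binary.PropositionalEquality

-- Polynomial inequalities are proved by exhibiting the slack s, a polynomial with
-- nonnegative coefficients, and checking the identity with the ring solver.
≤-by-slack : ∀ {a b} s → a + s ≡ b → a ≤ b
≤-by-slack {a} s refl = m≤m+n a s

≤-by-slack′ : ∀ {a b x y} s → x ≤ y → b + x ≡ a + s + y → a ≤ b
≤-by-slack′ {a} {b} {x} {y} s x≤y eq = +-cancelʳ-≤ y a b (begin
  a + y      ≤⟨ +-monoˡ-≤ y (m≤m+n a s) ⟩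
  a + s + y  ≡⟨ eq ⟨
  b + x      ≤⟨ +-monoʳ-≤ b x≤y ⟩
  b + y      ∎)
  where open ≤-Reasoning

n≤n*n : ∀ n → n ≤ n * n
n≤n*n zero      = z≤n
n≤n*n n@(suc _) = m≤m*n n n

[1+n]C2≡n+nC2 : ∀ n → suc n C 2 ≡ n + n C 2
[1+n]C2≡n+nC2 n = trans (sym (nCk+nC[k+1]≡[n+1]C[k+1] n 1)) (cong (_+ n C 2) (nC1≡n n))

2*nC2≡n*[n∸1] : ∀ n → 2 * (n C 2) ≡ n * (n ∸ 1)
2*nC2≡n*[n∸1] zero          = refl
2*nC2≡n*[n∸1] (suc zero)    = refl
2*nC2≡n*[n∸1] (suc (suc n)) = begin
  2 * (suc (suc n) C 2)       ≡⟨ cong (2 *_) ([1+n]C2≡n+nC2 (suc n)) ⟩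
  2 * (suc n + suc n C 2)     ≡⟨ *-distribˡ-+ 2 (suc n) (suc n C 2) ⟩
  2 * suc n + 2 * (suc n C 2) ≡⟨ cong (2 * suc n +_) (2*nC2≡n*[n∸1] (suc n)) ⟩
  2 * suc n + suc n * n       ≡⟨ solve (n ∷ []) ⟩
  suc (suc n) * suc n         ∎
  where open ≡-Reasoning

nC2≡0⇒n≤1 : ∀ n → n C 2 ≡ 0 → n ≤ 1
nC2≡0⇒n≤1 zero          _ = z≤n
nC2≡0⇒n≤1 (suc zero)    _ = s≤s z≤n
nC2≡0⇒n≤1 (suc (suc n)) eq with trans (cong (2 *_) (sym eq)) (2*nC2≡n*[n∸1] (suc (suc n)))
... | ()

2*m*n≤m*m+n*n : ∀ m n → 2 * m * n ≤ m * m + n * n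
2*m*n≤m*m+n*n m n with ≤-total m n
... | inj₁ m≤n with k , refl ← m≤n⇒∃[o]m+o≡n m≤n = ≤-by-slack (k * k) (solve (m ∷ k ∷ []))
... | inj₂ n≤m with k , refl ← m≤n⇒∃[o]m+o≡n n≤m = ≤-by-slack (k * k) (solve (n ∷ k ∷ []))

4*m*n≤[m+n]² : ∀ m n → 4 * m * n ≤ (m + n) * (m + n)
4*m*n≤[m+n]² m n = ≤-by-slack′ 0 (2*m*n≤m*m+n*n m n) (solve (m ∷ n ∷ []))

β*x<α*x²+γ : ∀ α β γ x → β * β < 4 * α * γ → β * x < α * (x * x) + γ
β*x<α*x²+γ zero    β γ x β²<0 = contradiction β²<0 n≮0
β*x<α*x²+γ α@(suc a) β γ x β²<4αγ = *-cancelˡ-< (4 * α) _ _ (begin-strict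
  4 * α * (β * x)                     ≡⟨ solve (a ∷ β ∷ x ∷ []) ⟩
  2 * β * (2 * α * x)                 ≤⟨ 2*m*n≤m*m+n*n β (2 * α * x) ⟩
  β * β + 2 * α * x * (2 * α * x)     <⟨ +-monoˡ-< _ β²<4αγ ⟩
  4 * α * γ + 2 * α * x * (2 * α * x) ≡⟨ solve (a ∷ γ ∷ x ∷ []) ⟩
  4 * α * (α * (x * x) + γ)           ∎)
  where open ≤-Reasoning

sum-tabulate-+ : ∀ {n} (f g : Fin n → ℕ) →
  sum (tabulate (λ i → f i + g i)) ≡ sum (tabulate f) + sum (tabulate g)
sum-tabulate-+ {zero}  f g = refl
sum-tabulate-+ {suc n} f g = begin
  f fzero + g fzero + sum (tabulate (λ i → f (fsuc i) + g (fsuc i)))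
    ≡⟨ cong (f fzero + g fzero +_) (sum-tabulate-+ (f ∘ fsuc) (g ∘ fsuc)) ⟩
  f fzero + g fzero + (sum (tabulate (f ∘ fsuc)) + sum (tabulate (g ∘ fsuc)))
    ≡⟨ +-interchange (f fzero) (g fzero) _ _ ⟩
  f fzero + sum (tabulate (f ∘ fsuc)) + (g fzero + sum (tabulate (g ∘ fsuc))) ∎
  where open ≡-Reasoning

sum-tabulate-*ˡ : ∀ {n} c (f : Fin n → ℕ) → sum (tabulate (λ i → c * f i)) ≡ c * sum (tabulate f)
sum-tabulate-*ˡ {zero}  c f = sym (*-zeroʳ c)
sum-tabulate-*ˡ {suc n} c f = trans (cong (c * f fzero +_) (sum-tabulate-*ˡ c (f ∘ fsuc)))
                                   (sym (*-distribˡ-+ c (f fzero) _))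

sum-tabulate-const : ∀ n c → sum (tabulate {n = n} (λ _ → c)) ≡ n * c
sum-tabulate-const zero    c = refl
sum-tabulate-const (suc n) c = cong (c +_) (sum-tabulate-const n c)

sum-tabulate-mono-≤ : ∀ {n} {f g : Fin n → ℕ} → (∀ i → f i ≤ g i) → sum (tabulate f) ≤ sum (tabulate g)
sum-tabulate-mono-≤ {zero}  f≤g = z≤n
sum-tabulate-mono-≤ {suc n} f≤g = +-mono-≤ (f≤g fzero) (sum-tabulate-mono-≤ (f≤g ∘ fsuc))

fallingProduct : ℕ → ℕ → ℕ
fallingProduct j k = product (applyUpTo (λ i → k ∸ suc i) j)

fallNum≡fallingProduct : ∀ j k → fallNum (suc j) k ≡ fallingProduct j k
fallNum≡fallingProduct j k = cong product (map-upTo (λ i → k ∸ suc i) j)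

fallingProduct-suc : ∀ j k → fallingProduct j (suc k) * (k ∸ j) ≡ k * fallingProduct j k
fallingProduct-suc zero    k       = *-comm 1 k
fallingProduct-suc (suc j) zero    = *-zeroʳ (fallingProduct (suc j) 1)
fallingProduct-suc (suc j) (suc k) = begin
  suc k * fallingProduct j (suc k) * (k ∸ j)   ≡⟨ *-assoc (suc k) (fallingProduct j (suc k)) (k ∸ j) ⟩
  suc k * (fallingProduct j (suc k) * (k ∸ j)) ≡⟨ cong (suc k *_) (fallingProduct-suc j k) ⟩
  suc k * (k * fallingProduct j k)             ∎
  where open ≡-Reasoning

fallingProduct-nonZero : ∀ {j k} → j < k → NonZero (fallingProduct j k)
fallingProduct-nonZero {j} {k} j<k =
  product≢0 (applyUpTo⁺₁ _ j (λ i<j → >-nonZero (m<n⇒0<n∸m (<-≤-trans (s≤s i<j) j<k))))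

binomial-lower-bound : ∀ u N → u ^ N * (u * u + N * u + N C 2) ≤ suc u ^ N * (u * u)
binomial-lower-bound u zero    = ≤-reflexive (solve (u ∷ []))
binomial-lower-bound u (suc N) = begin
  u ^ suc N * (u * u + suc N * u + suc N C 2)     ≡⟨ cong (λ x → u ^ suc N * (u * u + suc N * u + x)) ([1+n]C2≡n+nC2 N) ⟩
  u * u ^ N * (u * u + suc N * u + (N + N C 2))   ≤⟨ ≤-by-slack (u ^ N * (N C 2)) (expand u N (u ^ N) (N C 2)) ⟩
  suc u * (u ^ N * (u * u + N * u + N C 2))       ≤⟨ *-monoʳ-≤ (suc u) (binomial-lower-bound u N) ⟩
  suc u * (suc u ^ N * (u * u))                   ≡⟨ *-assoc (suc u) (suc u ^ N) (u * u) ⟨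
  suc u ^ suc N * (u * u)                         ∎
  where
  open ≤-Reasoning
  expand : ∀ u N P C → u * P * (u * u + suc N * u + (N + C)) + P * C ≡ suc u * (P * (u * u + N * u + C))
  expand = solve-∀

-- f(u) ≤ f(u + 1) with denominators cleared and the common factor (u - 1)⋯(u - p + 1) cancelled
maximizer-step : ∀ p ℓ u → suc p ≤ u → fLeq (suc p) ℓ u (suc u) →
                 (u ∸ p) * suc u ^ (ℓ ∸ 1) ≤ u ^ suc (ℓ ∸ 1)
maximizer-step p ℓ u p<u f[u]≤f[u+1] =
  *-cancelˡ-≤ (fallingProduct p u) {{fallingProduct-nonZero p<u}} (begin
    Fᵤ * ((u ∸ p) * X)          ≡⟨ x∙yz≈xz∙y Fᵤ (u ∸ p) X ⟩
    Fᵤ * X * (u ∸ p)            ≤⟨ *-monoˡ-≤ (u ∸ p) Fᵤ*X≤Fᵤ₊₁*Y ⟩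
    Fᵤ₊₁ * Y * (u ∸ p)          ≡⟨ xy∙z≈xz∙y Fᵤ₊₁ Y (u ∸ p) ⟩
    Fᵤ₊₁ * (u ∸ p) * Y          ≡⟨ cong (_* Y) (fallingProduct-suc p u) ⟩
    u * Fᵤ * Y                  ≡⟨ xy∙z≈y∙xz u Fᵤ Y ⟩
    Fᵤ * (u * Y)                ∎)
  where
  open ≤-Reasoning
  Fᵤ Fᵤ₊₁ X Y : ℕ
  Fᵤ = fallingProduct p u
  Fᵤ₊₁ = fallingProduct p (suc u)
  X = suc u ^ (ℓ ∸ 1)
  Y = u ^ (ℓ ∸ 1)
  Fᵤ*X≤Fᵤ₊₁*Y : Fᵤ * X ≤ Fᵤ₊₁ * Y
  Fᵤ*X≤Fᵤ₊₁*Y = subst₂ (λ a b → a * X ≤ b * Y)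
                  (fallNum≡fallingProduct p u) (fallNum≡fallingProduct p (suc u)) f[u]≤f[u+1]

binomial-step-bound : ∀ u v N .{{_ : NonZero u}} → v * suc u ^ N ≤ u ^ suc N →
                      v * (u * u + N * u + N C 2) ≤ u * u * u
binomial-step-bound u v N v[u+1]ᴺ≤uᴺ⁺¹ = *-cancelˡ-≤ (u ^ N) {{m^n≢0 u N}} (begin
  u ^ N * (v * T)             ≡⟨ x∙yz≈y∙xz (u ^ N) v T ⟩
  v * (u ^ N * T)             ≤⟨ *-monoʳ-≤ v (binomial-lower-bound u N) ⟩
  v * (suc u ^ N * (u * u))   ≡⟨ *-assoc v (suc u ^ N) (u * u) ⟨
  v * suc u ^ N * (u * u)     ≤⟨ *-monoˡ-≤ (u * u) v[u+1]ᴺ≤uᴺ⁺¹ ⟩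
  u * u ^ N * (u * u)         ≡⟨ regroup u (u ^ N) ⟩
  u ^ N * (u * u * u)         ∎)
  where
  open ≤-Reasoning
  T : ℕ
  T = u * u + N * u + N C 2
  regroup : ∀ u P → u * P * (u * u) ≡ P * (u * u * u)
  regroup = solve-∀

-- With m = v + p + 1 and u = m - 1, f(u) ≤ f(m) says v (1 + 1/u)^N ≤ u for N = ℓ - 1;
-- StepBound is its second-order binomial expansion, doubled to clear C(N, 2).
StepBound : ℕ → ℕ → ℕ → Set
StepBound p N v = v * (2 * u * u + 2 * N * u + N * (N ∸ 1)) ≤ 2 * (u * u * u)
  where
  u : ℕ
  u = v + p

maximizer⇒StepBound : ∀ p ℓ v → IsMaximizer (suc p) ℓ (v + suc p) → StepBound p (ℓ ∸ 1) v
maximizer⇒StepBound p ℓ zero    _           = z≤n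
maximizer⇒StepBound p ℓ (suc w) (_ , f≤f[m]) = begin
  v * (2 * u * u + 2 * N * u + N * (N ∸ 1))   ≡⟨ cong (λ x → v * (2 * u * u + 2 * N * u + x)) (2*nC2≡n*[n∸1] N) ⟨
  v * (2 * u * u + 2 * N * u + 2 * (N C 2))   ≡⟨ double v u N (N C 2) ⟩
  2 * (v * (u * u + N * u + N C 2))           ≤⟨ *-monoʳ-≤ 2 (binomial-step-bound u v N v[u+1]ᴺ≤uᴺ⁺¹) ⟩
  2 * (u * u * u)                             ∎
  where
  open ≤-Reasoning
  v u N : ℕ
  v = suc w
  u = v + p
  N = ℓ ∸ 1
  f[u]≤f[u+1] : fLeq (suc p) ℓ u (suc u)
  f[u]≤f[u+1] = subst (fLeq (suc p) ℓ u) (+-suc v p) (f≤f[m] u (s≤s (m≤n+m p w)))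
  v[u+1]ᴺ≤uᴺ⁺¹ : v * suc u ^ N ≤ u ^ suc N
  v[u+1]ᴺ≤uᴺ⁺¹ = subst (λ x → x * suc u ^ N ≤ u ^ suc N) (m+n∸n≡m v p)
                   (maximizer-step p ℓ u (s≤s (m≤n+m p w)) f[u]≤f[u+1])
  double : ∀ v u N C → v * (2 * u * u + 2 * N * u + 2 * C) ≡ 2 * (v * (u * u + N * u + C))
  double = solve-∀

E*F<p*ℓ : ∀ {p c d E F} → 1 ≤ p → d C 2 ≤ c → E + F ≡ suc p * d →
          E * F < p * (suc p + (suc p * c + E))
E*F<p*ℓ {suc q} {c} {zero} {E} {F} _ _ E+F≡r*0
  with refl ← m+n≡0⇒m≡0 E (trans E+F≡r*0 (*-zeroʳ (suc q))) = s≤s z≤n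
E*F<p*ℓ {suc q} {c} {suc e} {E} {F} _ C[d,2]≤c E+F≡r*d =
  by-quadratic q c e E F (β*x<α*x²+γ 1 (suc (suc q) * e + 1) _ E (discriminant q c e [1+e]e≤2c)) E+F≡r*d
  where
  [1+e]e≤2c : suc e * e ≤ 2 * c
  [1+e]e≤2c = subst (_≤ 2 * c) (2*nC2≡n*[n∸1] (suc e)) (*-monoʳ-≤ 2 C[d,2]≤c)
  discriminant : ∀ q c e → let p = suc q ; r = suc p in suc e * e ≤ 2 * c →
                 (r * e + 1) * (r * e + 1) < 4 * 1 * (p * (r + r * c))
  discriminant q c e h = ≤-by-slack′ (6 + 12 * q + 4 * e * q + 4 * q * q + 2 * e * e * q + 2 * e * q * q + e * e * q * q)
    (*-mono-≤ (≤-refl {2 * suc q * suc (suc q)}) h) (solve (q ∷ c ∷ e ∷ []))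
  by-quadratic : ∀ q c e E F → let p = suc q ; r = suc p in
                 (r * e + 1) * E < 1 * (E * E) + p * (r + r * c) → E + F ≡ r * suc e →
                 E * F < p * (r + (r * c + E))
  by-quadratic q c e E F h eq =
    ≤-by-slack′ 0 (+-mono-≤ h (≤-reflexive (cong (E *_) eq))) (solve (q ∷ c ∷ e ∷ E ∷ F ∷ []))

StepBound⇒2*g*v<p*r : ∀ {p g v} → 1 ≤ p → StepBound p (p + g) v → 2 * g * v < p * suc p
StepBound⇒2*g*v<p*r {suc q} {zero}  {v} _ _ = s≤s z≤n
StepBound⇒2*g*v<p*r {suc q} {suc h} {v} _ H = *-cancelˡ-< (v + 2 * suc q) _ _ (certificate q h v H)
  where
  certificate : ∀ q h v → let p = suc q ; g = suc h ; u = v + p ; N = p + g in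
                v * (2 * u * u + 2 * N * u + N * (q + g)) ≤ 2 * (u * u * u) →
                (v + 2 * p) * (2 * g * v) < (v + 2 * p) * (p * suc p)
  certificate q h v H = ≤-by-slack′ (1 + 4 * q + h * v + 2 * q * q + h * h * v) H (solve (q ∷ h ∷ v ∷ []))

-- The theorem scaled by 2r, with r = p + 1, m = v + r and ℓ = r + g, once 2 Σ C(aᵢ, 2) is bounded by Q
-- and r Q is rewritten as ℓ g + E F.
ScalarClaim : ℕ → ℕ → ℕ → ℕ → ℕ → Set
ScalarClaim p g E F v = let ℓ = suc p + g in (v + suc p) * (ℓ * g + E * F) < suc p * (ℓ * (p + g))

scalarClaim-v≡0 : ∀ {p g E F} → E * F < p * (suc p + g) → ScalarClaim p g E F 0
scalarClaim-v≡0 {p} {g} {E} {F} EF<pℓ = *-monoʳ-< (suc p) (begin-strict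
  ℓ * g + E * F    <⟨ +-monoʳ-< (ℓ * g) EF<pℓ ⟩
  ℓ * g + p * ℓ    ≡⟨ solve (p ∷ g ∷ []) ⟩
  ℓ * (p + g)      ∎)
  where
  open ≤-Reasoning
  ℓ : ℕ
  ℓ = suc p + g

scalarClaim-g≡E : ∀ {p d E F v} → d ≤ 1 → E + F ≡ suc p * d → 2 * E * v < p * suc p → ScalarClaim p E E F v
scalarClaim-g≡E {p} {d} {E} {F} {v} d≤1 E+F≡r*d 2Ev<pr = begin-strict
  (v + suc p) * ((suc p + E) * E + E * F)  ≡⟨ solve (p ∷ E ∷ F ∷ v ∷ []) ⟩
  (v + suc p) * (E * (suc p + (E + F)))    ≡⟨ cong (λ x → (v + suc p) * (E * (suc p + x))) E+F≡r*d ⟩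
  (v + suc p) * (E * (suc p + suc p * d))
    ≤⟨ *-monoʳ-≤ (v + suc p) (*-monoʳ-≤ E (+-monoʳ-≤ (suc p) (*-monoʳ-≤ (suc p) d≤1))) ⟩
  (v + suc p) * (E * (suc p + suc p * 1))  ≡⟨ solve (p ∷ E ∷ v ∷ []) ⟩
  suc p * ((v + suc p) * (2 * E))          <⟨ *-monoʳ-< (suc p) (certificate p E v (+-mono-≤ 2Ev<pr (n≤n*n E))) ⟩
  suc p * ((suc p + E) * (p + E))          ∎
  where
  open ≤-Reasoning
  certificate : ∀ p E v → suc (2 * E * v) + E ≤ p * suc p + E * E → (v + suc p) * (2 * E) < (suc p + E) * (p + E)
  certificate p E v h = ≤-by-slack′ 0 h (solve (p ∷ E ∷ v ∷ []))

StepBound⇒v*g*[ℓ+2p]≤2p³ : ∀ {p g v} → 1 ≤ p → 1 ≤ v → suc p ≤ g → StepBound p (p + g) v →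
                           v * g * (suc p + g + 2 * p) ≤ 2 * (p * p * p)
StepBound⇒v*g*[ℓ+2p]≤2p³ {suc q} {g} {suc w} _ _ r≤g H with h , refl ← m≤n⇒∃[o]m+o≡n r≤g = certificate q w h H
  where
  certificate : ∀ q w h → let p = suc q ; v = suc w ; g = suc p + h ; u = v + p ; N = p + g in
                v * (2 * u * u + 2 * N * u + N * (q + g)) ≤ 2 * (u * u * u) →
                v * g * (suc p + g + 2 * p) ≤ 2 * (p * p * p)
  certificate q w h H = ≤-by-slack′
    (h + 4 * w + h * q + 3 * h * w + 2 * q * w + 4 * w * w + h * q * w + 2 * h * w * w + 2 * q * w * w)
    H (solve (q ∷ w ∷ h ∷ []))

-- g (ℓ + 2p) ≥ r (2r + 2p), which exceeds 2p³ for p ≤ 3.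
v*g*[ℓ+2p]≤2p³⇒4≤p : ∀ {p g v} → 1 ≤ v → suc p ≤ g → v * g * (suc p + g + 2 * p) ≤ 2 * (p * p * p) → 4 ≤ p
v*g*[ℓ+2p]≤2p³⇒4≤p {p} {g} {v} 1≤v r≤g vg[ℓ+2p]≤2p³ with 4 ≤? p
... | yes 4≤p = 4≤p
... | no  4≰p = contradiction (≤-trans lower vg[ℓ+2p]≤2p³) (<⇒≱ (small p (≰⇒> 4≰p)))
  where
  lower : 1 * suc p * (suc p + suc p + 2 * p) ≤ v * g * (suc p + g + 2 * p)
  lower = *-mono-≤ (*-mono-≤ 1≤v r≤g) (+-monoˡ-≤ (2 * p) (+-monoʳ-≤ (suc p) r≤g))
  small : ∀ p → p < 4 → 2 * (p * p * p) < 1 * suc p * (suc p + suc p + 2 * p)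
  small 0 _ = ≤ᵇ⇒≤ _ _ tt
  small 1 _ = ≤ᵇ⇒≤ _ _ tt
  small 2 _ = ≤ᵇ⇒≤ _ _ tt
  small 3 _ = ≤ᵇ⇒≤ _ _ tt
  small (suc (suc (suc (suc _)))) (s≤s (s≤s (s≤s (s≤s ()))))

scalarClaim-r≤g : ∀ {p g E F v} → let ℓ = suc p + g in
                  suc p ≤ g → v * g * (ℓ + 2 * p) ≤ 2 * (p * p * p) → E * F * (ℓ + 4 * p) < p * (ℓ * ℓ) →
                  ScalarClaim p g E F v
scalarClaim-r≤g {p} {g} {E} {F} {v} r≤g vg[ℓ+2p]≤2p³ EF[ℓ+4p]<pℓ² with h , refl ← m≤n⇒∃[o]m+o≡n r≤g =
  *-cancelʳ-< (g * (suc p + g + 2 * p)) _ _ (certificate p h E F v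
    (+-mono-≤ (*-monoˡ-≤ (ℓ * g + E * F) vg[ℓ+2p]≤2p³) (*-monoˡ-≤ (suc p * g) EF[ℓ+4p]<pℓ²)))
  where
  ℓ : ℕ
  ℓ = suc p + g
  certificate : ∀ p h E F v → let g = suc p + h ; ℓ = suc p + g ; W = ℓ * g + E * F in
    v * g * (ℓ + 2 * p) * W + suc (E * F * (ℓ + 4 * p)) * (suc p * g) ≤ 2 * (p * p * p) * W + p * (ℓ * ℓ) * (suc p * g) →
    (v + suc p) * W * (g * (ℓ + 2 * p)) < suc p * (ℓ * (p + g)) * (g * (ℓ + 2 * p))
  certificate p h E F v H = ≤-by-slack′
    (h + 2 * p + h * p + 5 * p * p + 2 * E * F * p + 6 * h * p * p + 8 * p * p * p + 2 * E * F * h * p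
      + 4 * E * F * p * p + 2 * h * h * p * p + 6 * h * p * p * p + 4 * p * p * p * p + 2 * E * F * h * p * p)
    H (solve (p ∷ h ∷ E ∷ F ∷ v ∷ []))

-- Here b = d + c₀ and d = e + 2; C(d, 2) < b amounts to 2c₀ = (e + 1) e + 2t for some t.
-- The claim is proved for 2c₀ in place of c₀, after scaling by 8.
Z²<4αpb² : ∀ q e c₀ t → let p = 4 + q ; r = suc p ; d = 2 + e ; b = d + c₀ in
           2 * c₀ ≡ suc e * e + 2 * t →
           (p * b * e + b * d + 4 * p * d) * (p * b * e + b * d + 4 * p * d) < 4 * (5 * p + 1 + r * c₀) * p * (b * b)
Z²<4αpb² q e c₀ t 2c₀≡ = *-cancelˡ-< 8 _ _ (begin-strict
  8 * (Z * Z)                       ≡⟨ lhs q e c₀ ⟩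
  2 * (Z₂ (2 * c₀) * Z₂ (2 * c₀))   <⟨ subst (λ X → 2 * (Z₂ X * Z₂ X) < R X) (sym 2c₀≡) (certificate q e t) ⟩
  R (2 * c₀)                        ≡⟨ rhs q e c₀ ⟩
  8 * (4 * α * p * (b * b))         ∎)
  where
  open ≤-Reasoning
  p r d b Z α : ℕ
  p = 4 + q
  r = suc p
  d = 2 + e
  b = d + c₀
  Z = p * b * e + b * d + 4 * p * d
  α = 5 * p + 1 + r * c₀
  Z₂ R : ℕ → ℕ
  Z₂ X = p * (X + 2 * d) * e + (X + 2 * d) * d + 8 * p * d
  R X = 4 * (10 * p + 2 + r * X) * p * ((X + 2 * d) * (X + 2 * d))
  lhs : ∀ q e c₀ → let p = 4 + q ; d = 2 + e ; b = d + c₀ ; Z = p * b * e + b * d + 4 * p * d ; B₂ = 2 * c₀ + 2 * d in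
        8 * (Z * Z) ≡ 2 * ((p * B₂ * e + B₂ * d + 8 * p * d) * (p * B₂ * e + B₂ * d + 8 * p * d))
  lhs q e c₀ = solve (q ∷ e ∷ c₀ ∷ [])
  rhs : ∀ q e c₀ → let p = 4 + q ; r = suc p ; d = 2 + e ; b = d + c₀ ; α = 5 * p + 1 + r * c₀ ; B₂ = 2 * c₀ + 2 * d in
        4 * (10 * p + 2 + r * (2 * c₀)) * p * (B₂ * B₂) ≡ 8 * (4 * α * p * (b * b))
  rhs q e c₀ = solve (q ∷ e ∷ c₀ ∷ [])
  certificate : ∀ q e t → let p = 4 + q ; r = suc p ; d = 2 + e ; X = suc e * e + 2 * t ; B₂ = X + 2 * d in
                2 * ((p * B₂ * e + B₂ * d + 8 * p * d) * (p * B₂ * e + B₂ * d + 8 * p * d))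
                  < 4 * (10 * p + 2 + r * X) * p * (B₂ * B₂)
  certificate q e t = ≤-by-slack
    (383 + 704 * e + 12160 * t + 3000 * (e * e) + 9376 * e * t + 5216 * (t * t) + 1928 * (e * e * e) + 5056 * (e * e) * t
      + 2080 * e * (t * t) + 640 * (t * t * t) + 774 * (e * e * e * e) + 1480 * (e * e * e) * t + 760 * (e * e) * (t * t) + 220 * (e * e * e * e * e)
      + 280 * (e * e * e * e) * t + 30 * (e * e * e * e * e * e)
    + q * (640 + 1280 * e + 6144 * t + 2280 * (e * e) + 4832 * e * t + 2464 * (t * t) + 1324 * (e * e * e) + 2552 * (e * e) * t
      + 976 * e * (t * t) + 288 * (t * t * t) + 480 * (e * e * e * e) + 736 * (e * e * e) * t + 352 * (e * e) * (t * t) + 124 * (e * e * e * e * e)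
      + 136 * (e * e * e * e) * t + 16 * (e * e * e * e * e * e))
    + q * q * (128 + 256 * e + 768 * t + 360 * (e * e) + 608 * e * t + 288 * (t * t) + 196 * (e * e * e) + 312 * (e * e) * t
      + 112 * e * (t * t) + 32 * (t * t * t) + 66 * (e * e * e * e) + 88 * (e * e * e) * t + 40 * (e * e) * (t * t) + 16 * (e * e * e * e * e)
      + 16 * (e * e * e * e) * t + 2 * (e * e * e * e * e * e)))
    (solve (q ∷ e ∷ t ∷ []))

E*F*[ℓ+4p]<p*ℓ²-d≥2 : ∀ q e c₀ t E F → let p = 4 + q ; r = suc p ; d = 2 + e ; ℓ = r * (d + c₀) + E in
                      2 * c₀ ≡ suc e * e + 2 * t → E + F ≡ r * d → E * F * (ℓ + 4 * p) < p * (ℓ * ℓ)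
E*F*[ℓ+4p]<p*ℓ²-d≥2 q e c₀ t zero      F _ _ = s≤s z≤n
E*F*[ℓ+4p]<p*ℓ²-d≥2 q e c₀ t E@(suc _) F 2c₀≡ E+F≡r*d = +-cancelˡ-≤ (E * E * L) _ _ (begin
  E * E * L + suc (E * F * L)  ≡⟨ factor E F L ⟩
  suc (E * (E + F) * L)        ≡⟨ cong (λ x → suc (E * x * L)) E+F≡r*d ⟩
  suc (E * (r * d) * L)        ≤⟨ cubic q e c₀ E (+-mono-≤ (β*x<α*x²+γ α β γ E disc) (m≤m*n (E * E) E)) ⟩
  p * (ℓ * ℓ) + E * E * L      ≡⟨ +-comm (p * (ℓ * ℓ)) (E * E * L) ⟩
  E * E * L + p * (ℓ * ℓ)      ∎)
  where
  open ≤-Reasoning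
  p r d b ℓ L Z α β γ : ℕ
  p = 4 + q
  r = suc p
  d = 2 + e
  b = d + c₀
  ℓ = r * b + E
  L = ℓ + 4 * p
  Z = p * b * e + b * d + 4 * p * d
  α = 5 * p + 1 + r * c₀
  β = r * Z
  γ = p * r * r * b * b
  disc : β * β < 4 * α * γ
  disc = subst₂ _<_ (scale-lhs r Z) (scale-rhs r α p b) (*-monoʳ-< (r * r) (Z²<4αpb² q e c₀ t 2c₀≡))
    where
    scale-lhs : ∀ r Z → r * r * (Z * Z) ≡ r * Z * (r * Z)
    scale-lhs = solve-∀
    scale-rhs : ∀ r α p b → r * r * (4 * α * p * (b * b)) ≡ 4 * α * (p * r * r * b * b)
    scale-rhs = solve-∀
  factor : ∀ E F L → E * E * L + suc (E * F * L) ≡ suc (E * (E + F) * L)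
  factor = solve-∀
  -- p ℓ² + E² L − E r d L = E³ + (α − 1) E² − β E + γ as a polynomial in E
  cubic : ∀ q e c₀ E →
          let p = 4 + q ; r = suc p ; d = 2 + e ; b = d + c₀ ; ℓ = r * b + E ; L = ℓ + 4 * p
              α = 5 * p + 1 + r * c₀ ; β = r * (p * b * e + b * d + 4 * p * d) ; γ = p * r * r * b * b
          in
          suc (β * E) + E * E ≤ α * (E * E) + γ + E * E * E → suc (E * (r * d) * L) ≤ p * (ℓ * ℓ) + E * E * L
  cubic q e c₀ E h = ≤-by-slack′ 0 h (solve (q ∷ e ∷ c₀ ∷ E ∷ []))

E*F*[ℓ+4p]<p*ℓ² : ∀ {p c d E F} → 4 ≤ p → 1 ≤ c → d C 2 ≤ c → E + F ≡ suc p * d →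
                  let ℓ = suc p + (suc p * c + E) in E * F * (ℓ + 4 * p) < p * (ℓ * ℓ)
E*F*[ℓ+4p]<p*ℓ² {suc (suc (suc (suc q)))} {c} {zero} {E} {F} (s≤s (s≤s (s≤s (s≤s _)))) _ _ E+F≡r*0
  with refl ← m+n≡0⇒m≡0 E (trans E+F≡r*0 (*-zeroʳ (5 + q))) = s≤s z≤n
E*F*[ℓ+4p]<p*ℓ² {suc (suc (suc (suc q)))} {suc c} {1} {E} {F} (s≤s (s≤s (s≤s (s≤s _)))) (s≤s _) _ E+F≡r*1 =
  *-cancelˡ-< 4 _ _ (begin-strict
    4 * (E * F * L)          ≡⟨ regroup E F L ⟩
    4 * E * F * L            ≤⟨ *-monoˡ-≤ L (4*m*n≤[m+n]² E F) ⟩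
    (E + F) * (E + F) * L    ≡⟨ cong (λ x → x * x * L) E+F≡r*1 ⟩
    r * 1 * (r * 1) * L      <⟨ certificate q c E ⟩
    4 * (p * (ℓ * ℓ))        ∎)
  where
  open ≤-Reasoning
  p r ℓ L : ℕ
  p = 4 + q
  r = suc p
  ℓ = r + (r * suc c + E)
  L = ℓ + 4 * p
  regroup : ∀ E F L → 4 * (E * F * L) ≡ 4 * E * F * L
  regroup = solve-∀
  certificate : ∀ q c E → let p = 4 + q ; r = suc p ; ℓ = r + (r * suc c + E) in
                r * 1 * (r * 1) * (ℓ + 4 * p) < 4 * (p * (ℓ * ℓ))
  certificate q c E = ≤-by-slack
    (949 + 295 * E + 1475 * c + 630 * q + 16 * E * E + 160 * E * c + 134 * E * q + 400 * c * c + 965 * c * q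
      + 138 * q * q + 4 * E * E * q + 72 * E * c * q + 15 * E * q * q + 260 * c * c * q + 209 * c * q * q
      + 10 * q * q * q + 8 * E * c * q * q + 56 * c * c * q * q + 15 * c * q * q * q + 4 * c * c * q * q * q)
    (solve (q ∷ c ∷ E ∷ []))
E*F*[ℓ+4p]<p*ℓ² {p@(suc (suc (suc (suc q))))} {c} {suc (suc e)} {E} {F} (s≤s (s≤s (s≤s (s≤s _)))) _ C[d,2]≤c E+F≡r*d =
  subst (λ ℓ → E * F * (ℓ + 4 * p) < p * (ℓ * ℓ)) ℓ≡ (E*F*[ℓ+4p]<p*ℓ²-d≥2 q e c₀ t E F 2c₀≡ E+F≡r*d)
  where
  k t c₀ : ℕ
  k = suc e C 2
  t = c ∸ suc (suc e) C 2
  c₀ = k + t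
  c≡ : c ≡ suc e + c₀
  c≡ = trans (sym (m+[n∸m]≡n C[d,2]≤c)) (trans (cong (_+ t) ([1+n]C2≡n+nC2 (suc e))) (+-assoc (suc e) k t))
  2c₀≡ : 2 * c₀ ≡ suc e * e + 2 * t
  2c₀≡ = trans (*-distribˡ-+ 2 k t) (cong (_+ 2 * t) (2*nC2≡n*[n∸1] (suc e)))
  ℓ≡ : suc p * (2 + e + c₀) + E ≡ suc p + (suc p * c + E)
  ℓ≡ = trans (regroup p e c₀ E) (cong (λ x → suc p + (suc p * x + E)) (sym c≡))
    where
    regroup : ∀ p e c₀ E → suc p * (2 + e + c₀) + E ≡ suc p + (suc p * (suc e + c₀) + E)
    regroup = solve-∀

scalarClaim : ∀ {p c d E F} v → 1 ≤ p → d C 2 ≤ c → E + F ≡ suc p * d →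
              StepBound p (p + (suc p * c + E)) v → ScalarClaim p (suc p * c + E) E F v
scalarClaim {p} {c} {d} {E} {F} zero 1≤p C[d,2]≤c E+F≡r*d _ =
  scalarClaim-v≡0 {p} {suc p * c + E} {E} {F} (E*F<p*ℓ {p} {c} {d} 1≤p C[d,2]≤c E+F≡r*d)
scalarClaim {p} {zero} {d} {E} {F} v@(suc _) 1≤p C[d,2]≤0 E+F≡r*d H =
  subst (λ g → ScalarClaim p g E F v) (sym g≡E)
    (scalarClaim-g≡E {v = v} d≤1 E+F≡r*d
      (subst (λ g → 2 * g * v < p * suc p) g≡E (StepBound⇒2*g*v<p*r {g = suc p * 0 + E} 1≤p H)))
  where
  g≡E : suc p * 0 + E ≡ E
  g≡E = cong (_+ E) (*-zeroʳ (suc p))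
  d≤1 : d ≤ 1
  d≤1 = nC2≡0⇒n≤1 d (n≤0⇒n≡0 C[d,2]≤0)
scalarClaim {p} {suc c} {d} {E} {F} v@(suc _) 1≤p C[d,2]≤c E+F≡r*d H =
  scalarClaim-r≤g {E = E} {F} {v} r≤g vg[ℓ+2p]≤2p³ (E*F*[ℓ+4p]<p*ℓ² 4≤p (s≤s z≤n) C[d,2]≤c E+F≡r*d)
  where
  g : ℕ
  g = suc p * suc c + E
  r≤g : suc p ≤ g
  r≤g = ≤-trans (m≤m*n (suc p) (suc c)) (m≤m+n (suc p * suc c) E)
  vg[ℓ+2p]≤2p³ : v * g * (suc p + g + 2 * p) ≤ 2 * (p * p * p)
  vg[ℓ+2p]≤2p³ = StepBound⇒v*g*[ℓ+2p]≤2p³ {v = v} 1≤p (s≤s z≤n) r≤g H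
  4≤p : 4 ≤ p
  4≤p = v*g*[ℓ+2p]≤2p³⇒4≤p {v = v} (s≤s z≤n) r≤g vg[ℓ+2p]≤2p³

excess : ∀ {n} → (Fin n → ℕ) → ℕ → ℕ
excess a b = sum (tabulate (λ i → a i ∸ b))

total≡n*b+excess : ∀ {n} (a : Fin n → ℕ) b → (∀ i → b ≤ a i) → total a ≡ n * b + excess a b
total≡n*b+excess {n} a b b≤a = begin
  sum (tabulate a)                           ≡⟨ cong sum (tabulate-cong (λ i → sym (m+[n∸m]≡n (b≤a i)))) ⟩
  sum (tabulate (λ i → b + (a i ∸ b)))       ≡⟨ sum-tabulate-+ (λ _ → b) (λ i → a i ∸ b) ⟩
  sum (tabulate {n = n} (λ _ → b)) + excess a b ≡⟨ cong (_+ excess a b) (sum-tabulate-const n b) ⟩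
  n * b + excess a b                         ∎
  where open ≡-Reasoning

excess≤n*d : ∀ {n} (a : Fin n → ℕ) b d → (∀ i → a i ∸ b ≤ d) → excess a b ≤ n * d
excess≤n*d {n} a b d a∸b≤d = ≤-trans (sum-tabulate-mono-≤ a∸b≤d) (≤-reflexive (sum-tabulate-const n d))

2*sumPairs≤ : ∀ {n} (a : Fin n → ℕ) c d → (∀ i → suc c ≤ a i) → (∀ i → a i ∸ suc c ≤ d) →
              2 * sumPairs a ≤ n * (suc c * c) + (2 * c + 1 + d) * excess a (suc c)
2*sumPairs≤ {n} a c d b≤a a∸b≤d = begin
  2 * sumPairs a                                         ≡⟨ sum-tabulate-*ˡ 2 (λ i → a i C 2) ⟨
  sum (tabulate (λ i → 2 * (a i C 2)))                   ≡⟨ cong sum (tabulate-cong (λ i → 2*nC2≡n*[n∸1] (a i))) ⟩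
  sum (tabulate (λ i → a i * (a i ∸ 1)))                 ≤⟨ sum-tabulate-mono-≤ pair-bound ⟩
  sum (tabulate (λ i → suc c * c + (2 * c + 1 + d) * (a i ∸ suc c)))
    ≡⟨ sum-tabulate-+ (λ _ → suc c * c) (λ i → (2 * c + 1 + d) * (a i ∸ suc c)) ⟩
  sum (tabulate {n = n} (λ _ → suc c * c)) + sum (tabulate (λ i → (2 * c + 1 + d) * (a i ∸ suc c)))
    ≡⟨ cong₂ _+_ (sum-tabulate-const n (suc c * c)) (sum-tabulate-*ˡ (2 * c + 1 + d) (λ i → a i ∸ suc c)) ⟩
  n * (suc c * c) + (2 * c + 1 + d) * excess a (suc c)   ∎
  where
  open ≤-Reasoning
  certificate : ∀ c d e → e * e ≤ e * d → (suc c + e) * (c + e) ≤ suc c * c + (2 * c + 1 + d) * e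
  certificate c d e h = ≤-by-slack′ 0 h (solve (c ∷ d ∷ e ∷ []))
  pair-bound : ∀ i → a i * (a i ∸ 1) ≤ suc c * c + (2 * c + 1 + d) * (a i ∸ suc c)
  pair-bound i = subst (λ x → x * (x ∸ 1) ≤ suc c * c + (2 * c + 1 + d) * (a i ∸ suc c)) (m+[n∸m]≡n (b≤a i))
                   (certificate c d (a i ∸ suc c) (*-monoʳ-≤ (a i ∸ suc c) (a∸b≤d i)))

r*Q≡ℓ*g+E*F : ∀ {p c d E F} → E + F ≡ suc p * d →
              suc p * (suc p * (suc c * c) + (2 * c + 1 + d) * E) ≡ (suc p + (suc p * c + E)) * (suc p * c + E) + E * F
r*Q≡ℓ*g+E*F {p} {c} {d} {E} {F} E+F≡r*d = begin
  suc p * (suc p * (suc c * c) + (2 * c + 1 + d) * E)             ≡⟨ solve (p ∷ c ∷ d ∷ E ∷ []) ⟩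
  suc p * (suc p * (suc c * c) + (2 * c + 1) * E) + suc p * d * E
    ≡⟨ cong (λ x → suc p * (suc p * (suc c * c) + (2 * c + 1) * E) + x * E) E+F≡r*d ⟨
  suc p * (suc p * (suc c * c) + (2 * c + 1) * E) + (E + F) * E   ≡⟨ solve (p ∷ c ∷ E ∷ F ∷ []) ⟩
  (suc p + (suc p * c + E)) * (suc p * c + E) + E * F             ∎
  where open ≡-Reasoning

m*Q<ℓ*[ℓ∸1] : ∀ {p c d E F} m → 1 ≤ p → suc p ≤ m → d C 2 ≤ c → E + F ≡ suc p * d →
              let g = suc p * c + E ; ℓ = suc p + g in StepBound p (p + g) (m ∸ suc p) →
              m * (suc p * (suc c * c) + (2 * c + 1 + d) * E) < ℓ * (p + g)
m*Q<ℓ*[ℓ∸1] {p} {c} {d} {E} {F} m 1≤p r≤m C[d,2]≤c E+F≡r*d H = *-cancelˡ-< (suc p) _ _ (begin-strict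
  suc p * (m * Q)                ≡⟨ x∙yz≈y∙xz (suc p) m Q ⟩
  m * (suc p * Q)                ≡⟨ cong (m *_) (r*Q≡ℓ*g+E*F {p} {c} E+F≡r*d) ⟩
  m * (ℓ * g + E * F)            ≡⟨ cong (_* (ℓ * g + E * F)) (m∸n+n≡m r≤m) ⟨
  (m ∸ suc p + suc p) * (ℓ * g + E * F) <⟨ scalarClaim (m ∸ suc p) 1≤p C[d,2]≤c E+F≡r*d H ⟩
  suc p * (ℓ * (p + g))          ∎)
  where
  open ≤-Reasoning
  g ℓ Q : ℕ
  g = suc p * c + E
  ℓ = suc p + g
  Q = suc p * (suc c * c) + (2 * c + 1 + d) * E

m*sumPairs<totalC2 : ∀ {p} (a : Fin (suc p) → ℕ) c d m → 1 ≤ p →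
                     (∀ i → suc c ≤ a i) → (∀ i → a i ∸ suc c ≤ d) → d C 2 ≤ c →
                     IsMaximizer (suc p) (total a) m → m * sumPairs a < total a C 2
m*sumPairs<totalC2 {p} a c d m 1≤p b≤a a∸b≤d C[d,2]≤c maximizer@(r≤m , _) = *-cancelˡ-< 2 _ _ (begin-strict
  2 * (m * sumPairs a)     ≡⟨ x∙yz≈y∙xz 2 m (sumPairs a) ⟩
  m * (2 * sumPairs a)     ≤⟨ *-monoʳ-≤ m (2*sumPairs≤ a c d b≤a a∸b≤d) ⟩
  m * (suc p * (suc c * c) + (2 * c + 1 + d) * E)
                           <⟨ m*Q<ℓ*[ℓ∸1] m 1≤p r≤m C[d,2]≤c E+F≡r*d H ⟩
  ℓ * (p + g)              ≡⟨ cong (λ x → x * (x ∸ 1)) ℓ≡ ⟨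
  total a * (total a ∸ 1)  ≡⟨ 2*nC2≡n*[n∸1] (total a) ⟨
  2 * (total a C 2)        ∎)
  where
  open ≤-Reasoning
  E F g ℓ : ℕ
  E = excess a (suc c)
  F = suc p * d ∸ E
  g = suc p * c + E
  ℓ = suc p + g
  E+F≡r*d : E + F ≡ suc p * d
  E+F≡r*d = m+[n∸m]≡n (excess≤n*d a (suc c) d a∸b≤d)
  ℓ≡ : total a ≡ ℓ
  ℓ≡ = trans (total≡n*b+excess a (suc c) b≤a) (trans (cong (_+ E) (*-suc (suc p) c)) (+-assoc (suc p) (suc p * c) E))
  H : StepBound p (p + g) (m ∸ suc p)
  H = subst (λ ℓ → StepBound p (ℓ ∸ 1) (m ∸ suc p)) ℓ≡
        (maximizer⇒StepBound p (total a) (m ∸ suc p) (subst (IsMaximizer (suc p) (total a)) (sym (m∸n+n≡m r≤m)) maximizer))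

lemma5p2 : (n : ℕ) → 1 ≤ n → (a : Fin (suc n) → ℕ)
    → (∀ i j → toℕ i ≤ toℕ j → a j ≤ a i) → 1 ≤ a (fromℕ n)
    → AlmostBalanced a
    → (m : ℕ) → IsMaximizer (suc n) (total a) m
    → m * sumPairs a < total a C 2
lemma5p2 p 1≤p a antitone 1≤aᵣ (_ , C[d,2]<aᵣ) m maximizer =
  m*sumPairs<totalC2 a c d m 1≤p b≤a a∸b≤d C[d,2]≤c maximizer
  where
  aᵣ c d : ℕ
  aᵣ = a (fromℕ p)
  c = aᵣ ∸ 1
  d = a fzero ∸ aᵣ
  [1+c]≡aᵣ : suc c ≡ aᵣ
  [1+c]≡aᵣ = m+[n∸m]≡n 1≤aᵣ
  b≤a : ∀ i → suc c ≤ a i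
  b≤a i = subst (_≤ a i) (sym [1+c]≡aᵣ) (antitone i (fromℕ p) (subst (toℕ i ≤_) (sym (toℕ-fromℕ p)) (toℕ≤pred[n] i)))
  a∸b≤d : ∀ i → a i ∸ suc c ≤ d
  a∸b≤d i = subst (λ b → a i ∸ b ≤ d) (sym [1+c]≡aᵣ) (∸-monoˡ-≤ aᵣ (antitone fzero i z≤n))
  C[d,2]≤c : d C 2 ≤ c
  C[d,2]≤c = ≤-pred (subst (d C 2 <_) (sym [1+c]≡aᵣ) C[d,2]<aᵣ)
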